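{- For all nonzero integers $k,\ell$, we have $\{\mathsf{E},\mathsf{div}_{k\ell}\}^\circ=\{\mathsf{E},\mathsf{div}_k,\mathsf{div}_\ell\}^\circ$.
   Context: $\mathsf{E}(x,y)=y$ if $x=0$ and $0$ otherwise; $\mathsf{div}_m(x)=\lfloor x/m\rfloor$. For a set $F$ of functions, $F^\circ$ is the set of all functions computed by circuits whose gates compute either affine functions with integer coefficients of their inputs or functions from $F$. -}

module Defs where

open import Data.Nat using (ℕ; zero; suc)
open import Data.Fin using (Fin)
import Data.Fin
open import Data.Integer using (ℤ; +_; -[1+_]; -_; _/ℕ_; _+_; _*_; 0ℤ)
open import Data.Vec.Functional using (Vector; _∷_)
open import Data.Product using (Σ; ∃)
open import Data.Sum using (_⊎_; inj₁; inj₂)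
open import Data.Unit using (⊤)
open import Relation.Binary.PropositionalEquality using (_≡_)

E : ℤ → ℤ → ℤ
E (+ zero)    y = y
E (+ suc _)   y = 0ℤ
E -[1+ _ ]    y = 0ℤ

-- div_m(x) = ⌊ x / m ⌋ (floor division, for any nonzero integer m).
-- For m > 0 this is  x /ℕ m  (floor); for m = -d < 0,  ⌊x/(-d)⌋ = ⌊(-x)/d⌋.
-- The value at m = 0 is irrelevant (never used) and set to 0.
div : ℤ → ℤ → ℤ
div (+ zero)   x = 0ℤ
div (+ suc n)  x = x /ℕ suc n
div -[1+ n ]   x = (- x) /ℕ suc n

record Basis : Set₁ where
  field
    Sym   : Set
    arity : Sym → ℕ
    fun   : (s : Sym) → (Fin (arity s) → ℤ) → ℤ
open Basis public

dot : ∀ {m} → (Fin m → ℤ) → (Fin m → ℤ) → ℤ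
dot {zero}  c v = 0ℤ
dot {suc m} c v = c Data.Fin.zero * v Data.Fin.zero + dot (λ i → c (Data.Fin.suc i)) (λ i → v (Data.Fin.suc i))

-- A gate with access to m previously computed values (inputs and earlier gates):
-- either an affine function with integer coefficients of them, or a basis
-- function applied to some of them.
data Gate (F : Basis) (m : ℕ) : Set where
  affine : (coeffs : Fin m → ℤ) (const : ℤ) → Gate F m
  basic  : (s : Sym F) → (wires : Fin (arity F s) → Fin m) → Gate F m

evalGate : ∀ {F m} → Gate F m → (Fin m → ℤ) → ℤ
evalGate (affine c b) v = dot c v + b
evalGate {F} (basic s w) v = fun F s (λ i → v (w i))

-- A circuit (straight-line program / DAG in topological order) where m values
-- are currently available; it ends by designating an output value.
data Circuit (F : Basis) : ℕ → Set where
  out  : ∀ {m} → Fin m → Circuit F m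
  _▹_  : ∀ {m} → Gate F m → Circuit F (suc m) → Circuit F m

eval : ∀ {F m} → Circuit F m → (Fin m → ℤ) → ℤ
eval (out i)   v = v i
eval (g ▹ c)   v = eval c (evalGate g v ∷ v)

_° : Basis → (n : ℕ) → ((Fin n → ℤ) → ℤ) → Set
(F °) n f = Σ (Circuit F n) λ C → ∀ v → eval C v ≡ f v

binE : (Fin 2 → ℤ) → ℤ
binE v = E (v Data.Fin.zero) (v (Data.Fin.suc Data.Fin.zero))

B-E-div : ℤ → Basis
B-E-div m = record
  { Sym = ⊤ ⊎ ⊤
  ; arity = λ { (inj₁ _) → 2 ; (inj₂ _) → 1 }
  ; fun = λ { (inj₁ _) v → binE v ; (inj₂ _) v → div m (v Data.Fin.zero) }
  }

B-E-div-div : ℤ → ℤ → Basis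
B-E-div-div k l = record
  { Sym = ⊤ ⊎ (⊤ ⊎ ⊤)
  ; arity = λ { (inj₁ _) → 2 ; (inj₂ (inj₁ _)) → 1 ; (inj₂ (inj₂ _)) → 1 }
  ; fun = λ { (inj₁ _) v → binE v
            ; (inj₂ (inj₁ _)) v → div k (v Data.Fin.zero)
            ; (inj₂ (inj₂ _)) v → div l (v Data.Fin.zero) }
  }

{-# OPTIONS --safe #-}
-- The two bases simulate each other gate by gate. Floor divisions compose,
-- ⌊⌊x/k⌋/l⌋ = ⌊x/(kl)⌋ for l > 0; for l < 0 write kl = (-k)(-l) and use
-- div_{-m}(y) = div_m(-y), which puts a negation before and after div_k.
-- Conversely div_k(x) = div_{kl}(l x) and div_l(x) = div_{kl}(k x). Replacing
-- every gate of a circuit by a short program over the other basis, and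
-- renumbering the wires read by later gates, translates circuits.
module Submission where

open import Defs
open import Data.Nat as ℕ using (ℕ; NonZero)
open import Data.Fin using (Fin; zero; suc)
open import Data.Integer
  using (ℤ; +_; +0; +[1+_]; -[1+_]; -_; _+_; _*_; _≤_; _<_; _/ℕ_; 0ℤ; 1ℤ; -1ℤ)
  renaming (suc to sucℤ)
open import Data.Integer.Properties
open import Data.Integer.DivMod using ([n/ℕd]*d≤n; n<s[n/ℕd]*d)
open import Data.Vec.Functional using (_∷_; head; tail; zipWith)
open import Data.Product using (_×_; _,_; ∃; proj₂)
open import Data.Sum using (inj₁; inj₂)
open import Data.Unit using (tt)
open import Function using (_∘_; id)
open import Algebra.Properties.CommutativeSemigroup +-commutativeSemigroup using (interchange)
open import Relation.Binary.PropositionalEquality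
open import Relation.Nullary using (contradiction)

/ℕ-unique : ∀ x q d .{{_ : NonZero d}} → q * + d ≤ x → x < sucℤ q * + d → x /ℕ d ≡ q
/ℕ-unique x q d@(ℕ.suc _) q*d≤x x<[q+1]*d =
  ≤-antisym (quotient-≤ ([n/ℕd]*d≤n x d) x<[q+1]*d) (quotient-≤ q*d≤x (n<s[n/ℕd]*d x d))
  where
  quotient-≤ : ∀ {p q} → p * + d ≤ x → x < sucℤ q * + d → p ≤ q
  quotient-≤ {p} {q} p*d≤x x<[q+1]*d = subst (p ≤_) (pred-suc q)
    (i<j⇒i≤pred[j] {j = sucℤ q} (*-cancelʳ-<-nonNeg (+ d) (≤-<-trans p*d≤x x<[q+1]*d)))

[i/ℕm]/ℕn≡i/ℕ[m*n] : ∀ x a b .{{_ : NonZero a}} .{{_ : NonZero b}} .{{_ : NonZero (a ℕ.* b)}} →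
        x /ℕ a /ℕ b ≡ x /ℕ (a ℕ.* b)
[i/ℕm]/ℕn≡i/ℕ[m*n] x a b = sym (/ℕ-unique x q (a ℕ.* b) lower upper)
  where
  open ≤-Reasoning
  p = x /ℕ a
  q = p /ℕ b
  lower : q * + (a ℕ.* b) ≤ x
  lower = begin
    q * + (a ℕ.* b)   ≡⟨ cong (q *_) (trans (pos-* a b) (*-comm (+ a) (+ b))) ⟩
    q * (+ b * + a)   ≡⟨ *-assoc q (+ b) (+ a) ⟨
    q * + b * + a     ≤⟨ *-monoʳ-≤-nonNeg (+ a) ([n/ℕd]*d≤n p b) ⟩
    p * + a           ≤⟨ [n/ℕd]*d≤n x a ⟩
    x                 ∎
  upper : x < sucℤ q * + (a ℕ.* b)
  upper = begin-strict
    x                        <⟨ n<s[n/ℕd]*d x a ⟩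
    sucℤ p * + a             ≤⟨ *-monoʳ-≤-nonNeg (+ a) (i<j⇒suc[i]≤j (n<s[n/ℕd]*d p b)) ⟩
    sucℤ q * + b * + a       ≡⟨ *-assoc (sucℤ q) (+ b) (+ a) ⟩
    sucℤ q * (+ b * + a)     ≡⟨ cong (sucℤ q *_) (trans (*-comm (+ b) (+ a)) (sym (pos-* a b))) ⟩
    sucℤ q * + (a ℕ.* b)     ∎

[n*i]/ℕ[m*n]≡i/ℕm : ∀ x a b .{{_ : NonZero a}} .{{_ : NonZero b}} .{{_ : NonZero (a ℕ.* b)}} →
                (+ b * x) /ℕ (a ℕ.* b) ≡ x /ℕ a
[n*i]/ℕ[m*n]≡i/ℕm x a b@(ℕ.suc _) = /ℕ-unique (+ b * x) p (a ℕ.* b) lower upper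
  where
  open ≤-Reasoning
  p = x /ℕ a
  lower : p * + (a ℕ.* b) ≤ + b * x
  lower = begin
    p * + (a ℕ.* b)   ≡⟨ cong (p *_) (pos-* a b) ⟩
    p * (+ a * + b)   ≡⟨ *-assoc p (+ a) (+ b) ⟨
    p * + a * + b     ≤⟨ *-monoʳ-≤-nonNeg (+ b) ([n/ℕd]*d≤n x a) ⟩
    x * + b           ≡⟨ *-comm x (+ b) ⟩
    + b * x           ∎
  upper : + b * x < sucℤ p * + (a ℕ.* b)
  upper = begin-strict
    + b * x                ≡⟨ *-comm (+ b) x ⟩
    x * + b                <⟨ *-monoʳ-<-pos (+ b) (n<s[n/ℕd]*d x a) ⟩
    sucℤ p * + a * + b     ≡⟨ *-assoc (sucℤ p) (+ a) (+ b) ⟩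
    sucℤ p * (+ a * + b)   ≡⟨ cong (sucℤ p *_) (pos-* a b) ⟨
    sucℤ p * + (a ℕ.* b)   ∎

div-neg : ∀ m x → div (- m) x ≡ div m (- x)
div-neg +0       x = refl
div-neg +[1+ n ] x = refl
div-neg -[1+ n ] x = cong (_/ℕ ℕ.suc n) (sym (neg-involutive x))

div-*-pos : ∀ k a x → div (k * +[1+ a ]) x ≡ div k x /ℕ ℕ.suc a
div-*-pos +0       a x = refl
div-*-pos +[1+ b ] a x = sym ([i/ℕm]/ℕn≡i/ℕ[m*n] x (ℕ.suc b) (ℕ.suc a))
div-*-pos -[1+ b ] a x = sym ([i/ℕm]/ℕn≡i/ℕ[m*n] (- x) (ℕ.suc b) (ℕ.suc a))

*-neg-swap : ∀ k l → k * (- l) ≡ (- k) * l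
*-neg-swap k l = trans (sym (neg-distribʳ-* k l)) (neg-distribˡ-* k l)

signum : ℤ → ℤ
signum (+ _)    = 1ℤ
signum -[1+ _ ] = -1ℤ

div-*-signum : ∀ k l x → div (k * l) x ≡ div l (signum l * div k (signum l * x))
div-*-signum k +0 x = cong (λ m → div m x) (*-zeroʳ k)
div-*-signum k +[1+ a ] x = begin
  div (k * +[1+ a ]) x                ≡⟨ div-*-pos k a x ⟩
  div k x /ℕ ℕ.suc a                  ≡⟨ cong (_/ℕ ℕ.suc a) (*-identityˡ (div k x)) ⟨
  (1ℤ * div k x) /ℕ ℕ.suc a           ≡⟨ cong (λ y → (1ℤ * div k y) /ℕ ℕ.suc a) (*-identityˡ x) ⟨
  (1ℤ * div k (1ℤ * x)) /ℕ ℕ.suc a    ∎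
  where open ≡-Reasoning
div-*-signum k -[1+ a ] x = begin
  div (k * -[1+ a ]) x
    ≡⟨ cong (λ m → div m x) (*-neg-swap k +[1+ a ]) ⟩
  div (- k * +[1+ a ]) x
    ≡⟨ div-*-pos (- k) a x ⟩
  div (- k) x /ℕ ℕ.suc a
    ≡⟨ cong (_/ℕ ℕ.suc a) (div-neg k x) ⟩
  div k (- x) /ℕ ℕ.suc a
    ≡⟨ cong (_/ℕ ℕ.suc a) (neg-involutive (div k (- x))) ⟨
  (- - div k (- x)) /ℕ ℕ.suc a
    ≡⟨ cong (λ y → (- y) /ℕ ℕ.suc a) (-1*i≡-i (div k (- x))) ⟨
  (- (-1ℤ * div k (- x))) /ℕ ℕ.suc a
    ≡⟨ cong (λ y → (- (-1ℤ * div k y)) /ℕ ℕ.suc a) (-1*i≡-i x) ⟨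
  (- (-1ℤ * div k (-1ℤ * x))) /ℕ ℕ.suc a
    ∎
  where open ≡-Reasoning

div-*-*-cancel-pos : ∀ k a x → div (k * +[1+ a ]) (+[1+ a ] * x) ≡ div k x
div-*-*-cancel-pos +0       a x = refl
div-*-*-cancel-pos +[1+ b ] a x = [n*i]/ℕ[m*n]≡i/ℕm x (ℕ.suc b) (ℕ.suc a)
div-*-*-cancel-pos -[1+ b ] a x =
  trans (cong (_/ℕ (ℕ.suc b ℕ.* ℕ.suc a)) (neg-distribʳ-* +[1+ a ] x))
        ([n*i]/ℕ[m*n]≡i/ℕm (- x) (ℕ.suc b) (ℕ.suc a))

div-*-*-cancel : ∀ k l x → l ≢ 0ℤ → div (k * l) (l * x) ≡ div k x
div-*-*-cancel k +0       x l≢0 = contradiction refl l≢0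
div-*-*-cancel k +[1+ a ] x l≢0 = div-*-*-cancel-pos k a x
div-*-*-cancel k -[1+ a ] x l≢0 = begin
  div (k * -[1+ a ]) (-[1+ a ] * x)
    ≡⟨ cong₂ div (*-neg-swap k +[1+ a ]) (sym (*-neg-swap +[1+ a ] x)) ⟩
  div (- k * +[1+ a ]) (+[1+ a ] * - x)  ≡⟨ div-*-*-cancel-pos (- k) a (- x) ⟩
  div (- k) (- x)                        ≡⟨ div-neg k (- x) ⟩
  div k (- - x)                          ≡⟨ cong (div k) (neg-involutive x) ⟩
  div k x                                ∎
  where open ≡-Reasoning

dot-zeroˡ : ∀ {m} (v : Fin m → ℤ) → dot (λ _ → 0ℤ) v ≡ 0ℤ
dot-zeroˡ {ℕ.zero}  v = refl
dot-zeroˡ {ℕ.suc m} v = trans (+-identityˡ _) (dot-zeroˡ (tail v))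

scaledUnit : ∀ {m} → Fin m → ℤ → Fin m → ℤ
scaledUnit zero    α zero    = α
scaledUnit zero    α (suc j) = 0ℤ
scaledUnit (suc i) α zero    = 0ℤ
scaledUnit (suc i) α (suc j) = scaledUnit i α j

dot-scaledUnit : ∀ {m} (i : Fin m) α v → dot (scaledUnit i α) v ≡ α * v i
dot-scaledUnit zero    α v = trans (cong (_+_ (α * head v)) (dot-zeroˡ (tail v))) (+-identityʳ _)
dot-scaledUnit (suc i) α v = trans (+-identityˡ _) (dot-scaledUnit i α (tail v))

dot-+ˡ : ∀ {m} (a b v : Fin m → ℤ) → dot (zipWith _+_ a b) v ≡ dot a v + dot b v
dot-+ˡ {ℕ.zero}  a b v = refl
dot-+ˡ {ℕ.suc m} a b v = begin
  (a₀ + b₀) * v₀ + dot (zipWith _+_ a' b') v'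
    ≡⟨ cong₂ _+_ (*-distribʳ-+ v₀ a₀ b₀) (dot-+ˡ a' b' v') ⟩
  (a₀ * v₀ + b₀ * v₀) + (dot a' v' + dot b' v')
    ≡⟨ interchange (a₀ * v₀) (b₀ * v₀) (dot a' v') (dot b' v') ⟩
  (a₀ * v₀ + dot a' v') + (b₀ * v₀ + dot b' v')
    ∎
  where
  open ≡-Reasoning
  a₀ = head a
  b₀ = head b
  v₀ = head v
  a' = tail a
  b' = tail b
  v' = tail v

dot-congʳ : ∀ {m} (c : Fin m → ℤ) {v w} → v ≗ w → dot c v ≡ dot c w
dot-congʳ {ℕ.zero}  c v≗w = refl
dot-congʳ {ℕ.suc m} c v≗w =
  cong₂ _+_ (cong (head c *_) (v≗w zero)) (dot-congʳ (tail c) (v≗w ∘ suc))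

reindex : ∀ {m m'} → (Fin m → ℤ) → (Fin m → Fin m') → Fin m' → ℤ
reindex {ℕ.zero}  c ρ = λ _ → 0ℤ
reindex {ℕ.suc m} c ρ = zipWith _+_ (scaledUnit (head ρ) (head c)) (reindex (tail c) (tail ρ))

dot-reindex : ∀ {m m'} (c : Fin m → ℤ) (ρ : Fin m → Fin m') v →
              dot (reindex c ρ) v ≡ dot c (v ∘ ρ)
dot-reindex {ℕ.zero}  c ρ v = dot-zeroˡ v
dot-reindex {ℕ.suc m} c ρ v =
  trans (dot-+ˡ (scaledUnit (head ρ) (head c)) (reindex (tail c) (tail ρ)) v)
        (cong₂ _+_ (dot-scaledUnit (head ρ) (head c) v) (dot-reindex (tail c) (tail ρ) v))

infixr 5 _⊳_

data Program (G : Basis) : ℕ → ℕ → Set where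
  done : ∀ {m} → Program G m m
  _⊳_  : ∀ {m m'} → Gate G m → Program G (ℕ.suc m) m' → Program G m m'

module _ {G : Basis} where

  run : ∀ {m m'} → Program G m m' → (Fin m → ℤ) → Fin m' → ℤ
  run done    v = v
  run (g ⊳ P) v = run P (evalGate g v ∷ v)

  prepend : ∀ {m m'} → Program G m m' → Circuit G m' → Circuit G m
  prepend done    C = C
  prepend (g ⊳ P) C = g ▹ prepend P C

  eval-prepend : ∀ {m m'} (P : Program G m m') C v → eval (prepend P C) v ≡ eval C (run P v)
  eval-prepend done    C v = refl
  eval-prepend (g ⊳ P) C v = eval-prepend P C (evalGate g v ∷ v)

  embed : ∀ {m m'} → Program G m m' → Fin m → Fin m'
  embed done    i = i
  embed (g ⊳ P) i = embed P (suc i)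

  run-embed : ∀ {m m'} (P : Program G m m') v i → run P v (embed P i) ≡ v i
  run-embed done    v i = refl
  run-embed (g ⊳ P) v i = run-embed P (evalGate g v ∷ v) (suc i)

Gadget : Basis → ℕ → Set
Gadget G m = ∃ λ p → Program G m (ℕ.suc p)

result : ∀ {G m} → Gadget G m → (Fin m → ℤ) → ℤ
result (_ , P) v = run P v zero

Extensional : Basis → Set
Extensional F = ∀ s {u u' : Fin (arity F s) → ℤ} → u ≗ u' → fun F s u ≡ fun F s u'

record Simulation (F G : Basis) : Set where
  field
    gadget         : ∀ {m} s → (Fin (arity F s) → Fin m) → Gadget G m
    gadget-correct : ∀ {m} s (w : Fin (arity F s) → Fin m) v →
                     result (gadget s w) v ≡ fun F s (v ∘ w)

module _ {F G : Basis} (F-ext : Extensional F) (S : Simulation F G) where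
  open Simulation S

  simulateGate : ∀ {m m'} → Gate F m → (Fin m → Fin m') → Gadget G m'
  simulateGate (affine c b) ρ = _ , affine (reindex c ρ) b ⊳ done
  simulateGate (basic s w)  ρ = gadget s (ρ ∘ w)

  simulateGate-correct : ∀ {m m'} (g : Gate F m) (ρ : Fin m → Fin m') {v v'} →
                         v' ∘ ρ ≗ v → result (simulateGate g ρ) v' ≡ evalGate g v
  simulateGate-correct (affine c b) ρ {v' = v'} v'ρ≗v =
    cong (_+ b) (trans (dot-reindex c ρ v') (dot-congʳ c v'ρ≗v))
  simulateGate-correct (basic s w)  ρ {v' = v'} v'ρ≗v =
    trans (gadget-correct s (ρ ∘ w) v') (F-ext s (v'ρ≗v ∘ w))

  extend : ∀ {m m' p} → Program G m' (ℕ.suc p) → (Fin m → Fin m') →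
           Fin (ℕ.suc m) → Fin (ℕ.suc p)
  extend P ρ zero    = zero
  extend P ρ (suc i) = embed P (ρ i)

  translate : ∀ {m m'} → Circuit F m → (Fin m → Fin m') → Circuit G m'
  translate (out i) ρ = out (ρ i)
  translate (g ▹ C) ρ = prepend P (translate C (extend P ρ))
    where P = proj₂ (simulateGate g ρ)

  translate-correct : ∀ {m m'} (C : Circuit F m) (ρ : Fin m → Fin m') {v v'} →
                      v' ∘ ρ ≗ v → eval (translate C ρ) v' ≡ eval C v
  translate-correct (out i) ρ v'ρ≗v = v'ρ≗v i
  translate-correct (g ▹ C) ρ {v} {v'} v'ρ≗v =
    trans (eval-prepend P _ v') (translate-correct C (extend P ρ) extended)
    where
    P = proj₂ (simulateGate g ρ)
    extended : run P v' ∘ extend P ρ ≗ evalGate g v ∷ v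
    extended zero    = simulateGate-correct g ρ v'ρ≗v
    extended (suc i) = trans (run-embed P v' (ρ i)) (v'ρ≗v i)

  simulate : ∀ n f → (F °) n f → (G °) n f
  simulate n f (C , C≗f) =
    translate C id , λ v → trans (translate-correct C id (λ _ → refl)) (C≗f v)

scale : ∀ {G m} → ℤ → Fin m → Gate G m
scale α i = affine (scaledUnit i α) 0ℤ

evalGate-scale : ∀ {G m} α (i : Fin m) v → evalGate {G} (scale α i) v ≡ α * v i
evalGate-scale α i v = trans (+-identityʳ _) (dot-scaledUnit i α v)

E-div-extensional : ∀ m → Extensional (B-E-div m)
E-div-extensional m (inj₁ _) u≗u' = cong₂ E (u≗u' zero) (u≗u' (suc zero))
E-div-extensional m (inj₂ _) u≗u' = cong (div m) (u≗u' zero)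

E-div-div-extensional : ∀ k l → Extensional (B-E-div-div k l)
E-div-div-extensional k l (inj₁ _)        u≗u' = cong₂ E (u≗u' zero) (u≗u' (suc zero))
E-div-div-extensional k l (inj₂ (inj₁ _)) u≗u' = cong (div k) (u≗u' zero)
E-div-div-extensional k l (inj₂ (inj₂ _)) u≗u' = cong (div l) (u≗u' zero)

E-div-div-simulates-E-div : ∀ k l → Simulation (B-E-div (k * l)) (B-E-div-div k l)
E-div-div-simulates-E-div k l = record { gadget = gadget ; gadget-correct = gadget-correct }
  where
  F = B-E-div (k * l)
  G = B-E-div-div k l
  σ = signum l
  gadget : ∀ {m} s → (Fin (arity F s) → Fin m) → Gadget G m
  gadget (inj₁ _) w = _ , basic (inj₁ tt) w ⊳ done
  gadget (inj₂ _) w = _ , scale σ (w zero) ⊳ basic (inj₂ (inj₁ tt)) (λ _ → zero)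
                        ⊳ scale σ zero ⊳ basic (inj₂ (inj₂ tt)) (λ _ → zero) ⊳ done
  gadget-correct : ∀ {m} s (w : Fin (arity F s) → Fin m) v →
                   result (gadget s w) v ≡ fun F s (v ∘ w)
  gadget-correct (inj₁ _) w v = refl
  gadget-correct (inj₂ _) w v = begin
    div l (evalGate (scale {G} σ zero) (div k y ∷ y ∷ v))
      ≡⟨ cong (div l) (evalGate-scale {G} σ zero (div k y ∷ y ∷ v)) ⟩
    div l (σ * div k y)
      ≡⟨ cong (λ z → div l (σ * div k z)) (evalGate-scale {G} σ (w zero) v) ⟩
    div l (σ * div k (σ * v (w zero)))
      ≡⟨ div-*-signum k l (v (w zero)) ⟨
    div (k * l) (v (w zero))
      ∎
    where
    open ≡-Reasoning
    y = evalGate (scale {G} σ (w zero)) v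

E-div-simulates-E-div-div : ∀ {k l} → k ≢ 0ℤ → l ≢ 0ℤ →
                            Simulation (B-E-div-div k l) (B-E-div (k * l))
E-div-simulates-E-div-div {k} {l} k≢0 l≢0 =
  record { gadget = gadget ; gadget-correct = gadget-correct }
  where
  F = B-E-div-div k l
  G = B-E-div (k * l)
  gadget : ∀ {m} s → (Fin (arity F s) → Fin m) → Gadget G m
  gadget (inj₁ _)        w = _ , basic (inj₁ tt) w ⊳ done
  gadget (inj₂ (inj₁ _)) w = _ , scale l (w zero) ⊳ basic (inj₂ tt) (λ _ → zero) ⊳ done
  gadget (inj₂ (inj₂ _)) w = _ , scale k (w zero) ⊳ basic (inj₂ tt) (λ _ → zero) ⊳ done
  gadget-correct : ∀ {m} s (w : Fin (arity F s) → Fin m) v →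
                   result (gadget s w) v ≡ fun F s (v ∘ w)
  gadget-correct (inj₁ _)        w v = refl
  gadget-correct (inj₂ (inj₁ _)) w v = begin
    div (k * l) (evalGate (scale {G} l (w zero)) v)
      ≡⟨ cong (div (k * l)) (evalGate-scale {G} l (w zero) v) ⟩
    div (k * l) (l * v (w zero))
      ≡⟨ div-*-*-cancel k l (v (w zero)) l≢0 ⟩
    div k (v (w zero))
      ∎
    where open ≡-Reasoning
  gadget-correct (inj₂ (inj₂ _)) w v = begin
    div (k * l) (evalGate (scale {G} k (w zero)) v)
      ≡⟨ cong (div (k * l)) (evalGate-scale {G} k (w zero) v) ⟩
    div (k * l) (k * v (w zero))
      ≡⟨ cong (λ m → div m (k * v (w zero))) (*-comm k l) ⟩
    div (l * k) (k * v (w zero))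
      ≡⟨ div-*-*-cancel l k (v (w zero)) k≢0 ⟩
    div l (v (w zero))
      ∎
    where open ≡-Reasoning

mainTheorem7 : (k l : ℤ) → k ≢ 0ℤ → l ≢ 0ℤ →
    (n : ℕ) (f : (Fin n → ℤ) → ℤ) →
    ((B-E-div (k * l) °) n f → (B-E-div-div k l °) n f)
    × ((B-E-div-div k l °) n f → (B-E-div (k * l) °) n f)
mainTheorem7 k l k≢0 l≢0 n f =
  simulate (E-div-extensional (k * l)) (E-div-div-simulates-E-div k l) n f ,
  simulate (E-div-div-extensional k l) (E-div-simulates-E-div-div k≢0 l≢0) n f
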